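{- Let $d\ge2$ and $p$ a prime, and let $\pi(\mathcal{G}_p)=\#\{P\in\mathbb{P}^{2d+1}(\mathbb{F}_p):\mathfrak{r}(P)\ne0\}/\#\mathbb{P}^{2d+1}(\mathbb{F}_p)$. Then (1) $\pi(\mathcal{G}_p)\ge p^{ -2d}$ for every prime $p$; (2) if $p>2d$, then $\pi(\mathcal{G}_p)\ge 1-\frac{2d}{p}$.
   Context: $\mathfrak{r}(x_0,\dots,x_d,y_0,\dots,y_d)\in\mathbb{Z}[x_0,\dots,y_d]$ is the resultant of the generic binary forms $\sum_{i=0}^dx_iX^iY^{d-i}$ and $\sum_{j=0}^dy_jX^jY^{d-j}$, homogeneous of degree $2d$; the condition $\mathfrak{r}(P)\neq0$ for $P\in\mathbb{P}^{2d+1}(\mathbb{F}_p)$ is well defined by homogeneity. $\pi(\mathcal{G}_p)$ is the local density at $p$ of the set of degree-$d$ rational maps with good reduction at $p$. -}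

module Defs where

open import Data.Bool using (Bool; true; false; if_then_else_; not)
open import Data.Nat as ℕ using (ℕ; zero; suc; _+_; _*_; _∸_; _≤ᵇ_; _≡ᵇ_)
open import Data.Nat.Divisibility using (_∣?_)
open import Data.Integer as ℤ using (ℤ; +_; ∣_∣)
open import Data.Fin using (Fin; toℕ; punchIn)
import Data.Fin as Fin
open import Data.Vec using (Vec; []; _∷_)
open import Data.List using (List; []; _∷_; [_]; map; concatMap; allFin; filterᵇ; length)
open import Data.Rational as ℚ using (ℚ; 0ℚ; _/_)
open import Relation.Nullary.Decidable using (⌊_⌋)

det : (n : ℕ) → (Fin n → Fin n → ℤ) → ℤ
det zero    M = + 1
det (suc n) M = go (allFin (suc n))
  where
  term : Fin (suc n) → ℤ
  term j = (if ⌊ 2 ∣? toℕ j ⌋ then + 1 else ℤ.- + 1)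
           ℤ.* M Fin.zero j
           ℤ.* det n (λ i k → M (Fin.suc i) (punchIn j k))
  go : List (Fin (suc n)) → ℤ
  go []       = + 0
  go (j ∷ js) = term j ℤ.+ go js

-- k-th coordinate of a vector over F_p = Fin p (lifted to ℤ as 0..p-1); 0 out of range.
nth : ∀ {p n} → Vec (Fin p) n → ℕ → ℤ
nth []       _       = + 0
nth (x ∷ xs) zero    = + toℕ x
nth (x ∷ xs) (suc k) = nth xs k

-- Sylvester matrix of f = Σ_i x_i X^i Y^(d-i), g = Σ_j y_j X^j Y^(d-j), where the
-- point P = (x_0,…,x_d,y_0,…,y_d) is a vector of length 2d+2.
-- Rows 0..d-1: shifted coefficients of f; rows d..2d-1: shifted coefficients of g.
sylvester : ∀ {p} (d : ℕ) → Vec (Fin p) (suc d + suc d) → Fin (d + d) → Fin (d + d) → ℤ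
sylvester d v r c =
  let i = toℕ r ; j = toℕ c
      isF = suc i ≤ᵇ d
      shift = if isF then i else i ∸ d
      offset = if isF then 0 else suc d
  in if (shift ≤ᵇ j) Data.Bool.∧ (j ∸ shift ≤ᵇ d)
     then nth v (offset + (j ∸ shift)) else + 0

resultant : ∀ {p} (d : ℕ) → Vec (Fin p) (suc d + suc d) → ℤ
resultant d v = det (d + d) (sylvester d v)

resNonzero : (p d : ℕ) → Vec (Fin p) (suc d + suc d) → Bool
resNonzero p d v = not ⌊ p ∣? ∣ resultant d v ∣ ⌋

allVecs : (p n : ℕ) → List (Vec (Fin p) n)
allVecs p zero    = [ [] ]
allVecs p (suc n) = concatMap (λ x → map (x ∷_) (allVecs p n)) (allFin p)

normalised : ∀ {p n} → Vec (Fin p) n → Bool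
normalised []       = false
normalised (x ∷ xs) = if toℕ x ≡ᵇ 0 then normalised xs else toℕ x ≡ᵇ 1

-- ℙ^(n-1)(F_p), as the list of normalised representatives of nonzero vectors in F_p^n.
projPoints : (p n : ℕ) → List (Vec (Fin p) n)
projPoints p n = filterᵇ normalised (allVecs p n)

-- a / b as a rational number (b = 0 never occurs below; it is sent to 0).
ratio : ℕ → ℕ → ℚ
ratio a zero    = 0ℚ
ratio a (suc b) = (+ a) / suc b

densityGood : (p d : ℕ) → ℚ
densityGood p d =
  ratio (length (filterᵇ (resNonzero p d) (projPoints p (suc d + suc d))))
        (length (projPoints p (suc d + suc d)))

-- Work in the affine chart x₀ = 1 of ℙ^(2d+1)(𝔽_p) and fix x₁, …, x_d and y₀, …, y_(d-1). The
-- Sylvester matrix is then affine in y_d: its slope is the identity on the g-rows and zero on the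
-- f-rows, and the f-rows are upper unitriangular because x₀ = 1. Hence 𝔯 is a monic polynomial of
-- degree d in y_d, with at most d roots mod p, so at least p^(2d) (p − d) points of the chart are
-- good. Since #ℙ^(2d+1)(𝔽_p) · (p − 1) ≤ p^(2d+2), this gives π(𝒢_p) ≥ (1 − d/p)(1 − 1/p) ≥ 1 − 2d/p.
-- For (1), y = (0, …, 0, 1), i.e. g = Xᵈ, gives 𝔯 = x₀ᵈ = 1 whatever x₁, …, x_d are, so at least
-- pᵈ points are good, and pᵈ · p^(2d) ≥ p^(2d+2) ≥ #ℙ^(2d+1)(𝔽_p) as soon as d ≥ 2.

module Submission where

open import Defs

module Counting where

  open import Data.Bool using (Bool; true; false; not; T; _∧_; if_then_else_)
  open import Data.Fin using (Fin; zero; suc; _≟_)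
  import Data.Fin as Fin
  open import Data.List using (List; []; _∷_; [_]; _++_; map; concatMap; allFin; tabulate; filterᵇ; length)
  open import Data.List.Membership.Propositional using (_∈_; lose)
  open import Data.List.Membership.Propositional.Properties using (∈-allFin; ∈-map⁺; ∈-concatMap⁺)
  open import Data.List.Properties using (length-++; concatMap-pure; concatMap-map; filter-++; filter-accept; filter-reject; filter-some; map-tabulate; length-tabulate)
  open import Data.List.Relation.Unary.Any using (here)
  open import Data.Nat using (ℕ; zero; suc; _+_; _*_; _^_; _∸_; _≤_; _<_; z≤n; s≤s)
  open import Data.Nat.Properties hiding (_≟_)
  open import Data.Product using (∃; _,_)
  open import Data.Sum using (_⊎_; inj₁; inj₂)
  import Data.Sum as Sum
  open import Data.Unit using (tt)
  open import Data.Vec using (Vec; []; _∷_; _∷ʳ_)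
  import Data.Vec as Vec
  open import Function using (_∘_; id)
  open import Relation.Nullary using (¬_; yes; no; does)
  open import Relation.Nullary.Decidable using (T?)
  open import Relation.Binary.PropositionalEquality using (_≡_; refl; sym; trans; cong; cong₂; subst; module ≡-Reasoning)

  private variable
    A B : Set
    n : ℕ

  count : (A → Bool) → List A → ℕ
  count P xs = length (filterᵇ P xs)

  count-++ : (P : A → Bool) (xs ys : List A) → count P (xs ++ ys) ≡ count P xs + count P ys
  count-++ P xs ys = trans (cong length (filter-++ (T? ∘ P) xs ys)) (length-++ (filterᵇ P xs))

  count-map : (P : B → Bool) (f : A → B) (xs : List A) → count P (map f xs) ≡ count (P ∘ f) xs
  count-map P f []       = refl
  count-map P f (x ∷ xs) with P (f x)
  ... | true  = cong suc (count-map P f xs)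
  ... | false = count-map P f xs

  count-cong : {P Q : A → Bool} → (∀ x → P x ≡ Q x) → (xs : List A) → count P xs ≡ count Q xs
  count-cong P≗Q []       = refl
  count-cong {P = P} {Q} P≗Q (x ∷ xs) with P x | Q x | P≗Q x
  ... | true  | true  | refl = cong suc (count-cong P≗Q xs)
  ... | false | false | refl = count-cong P≗Q xs

  count-false : {P : A → Bool} → (∀ x → P x ≡ false) → (xs : List A) → count P xs ≡ 0
  count-false P≗false []       = refl
  count-false {P = P} P≗false (x ∷ xs) with P x | P≗false x
  ... | false | refl = count-false P≗false xs

  count-true : (xs : List A) → count (λ _ → true) xs ≡ length xs
  count-true []       = refl
  count-true (x ∷ xs) = cong suc (count-true xs)

  count-+-count-not : (P : A → Bool) (xs : List A) → count P xs + count (not ∘ P) xs ≡ length xs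
  count-+-count-not P []       = refl
  count-+-count-not P (x ∷ xs) with P x
  ... | true  = cong suc (count-+-count-not P xs)
  ... | false = trans (+-suc _ _) (cong suc (count-+-count-not P xs))

  count-accept : (P : A → Bool) {x : A} {xs : List A} → T (P x) → count P (x ∷ xs) ≡ suc (count P xs)
  count-accept P Px = cong length (filter-accept (T? ∘ P) Px)

  count-reject : (P : A → Bool) {x : A} {xs : List A} → ¬ T (P x) → count P (x ∷ xs) ≡ count P xs
  count-reject P ¬Px = cong length (filter-reject (T? ∘ P) ¬Px)

  count-≤-∷ : (P : A → Bool) (x : A) (xs : List A) → count P xs ≤ count P (x ∷ xs)
  count-≤-∷ P x xs with P x
  ... | true  = n≤1+n _
  ... | false = ≤-refl

  count-not : (P : A → Bool) (xs : List A) → count (not ∘ P) xs ≡ length xs ∸ count P xs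
  count-not P xs = trans (sym (m+n∸m≡n (count P xs) _)) (cong (_∸ count P xs) (count-+-count-not P xs))

  count-∪ : {P Q R : A → Bool} → (∀ x → T (P x) → T (Q x) ⊎ T (R x)) →
            (xs : List A) → count P xs ≤ count Q xs + count R xs
  count-∪ P⊆Q∪R [] = z≤n
  count-∪ {P = P} {Q} {R} P⊆Q∪R (x ∷ xs) with ih ← count-∪ P⊆Q∪R xs | T? (P x)
  ... | no ¬Px = begin
    count P (x ∷ xs)                  ≡⟨ count-reject P ¬Px ⟩
    count P xs                        ≤⟨ ih ⟩
    count Q xs + count R xs           ≤⟨ +-mono-≤ (count-≤-∷ Q x xs) (count-≤-∷ R x xs) ⟩
    count Q (x ∷ xs) + count R (x ∷ xs) ∎
    where open ≤-Reasoning
  ... | yes Px with P⊆Q∪R x Px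
  ...   | inj₁ Qx = begin
    count P (x ∷ xs)                  ≡⟨ count-accept P Px ⟩
    suc (count P xs)                  ≤⟨ s≤s ih ⟩
    suc (count Q xs) + count R xs     ≤⟨ +-mono-≤ (≤-reflexive (sym (count-accept Q Qx))) (count-≤-∷ R x xs) ⟩
    count Q (x ∷ xs) + count R (x ∷ xs) ∎
    where open ≤-Reasoning
  ...   | inj₂ Rx = begin
    count P (x ∷ xs)                  ≡⟨ count-accept P Px ⟩
    suc (count P xs)                  ≤⟨ s≤s ih ⟩
    suc (count Q xs + count R xs)     ≡⟨ +-suc (count Q xs) (count R xs) ⟨
    count Q xs + suc (count R xs)     ≤⟨ +-mono-≤ (count-≤-∷ Q x xs) (≤-reflexive (sym (count-accept R Rx))) ⟩
    count Q (x ∷ xs) + count R (x ∷ xs) ∎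
    where open ≤-Reasoning

  count-≡0⊎witness : (P : A → Bool) (xs : List A) → count P xs ≡ 0 ⊎ ∃ λ x → T (P x)
  count-≡0⊎witness P []       = inj₁ refl
  count-≡0⊎witness P (x ∷ xs) with T? (P x)
  ... | yes Px  = inj₂ (x , Px)
  ... | no  ¬Px = Sum.map₁ (trans (count-reject P ¬Px)) (count-≡0⊎witness P xs)

  count-member : (P : A → Bool) {x : A} {xs : List A} → x ∈ xs → T (P x) → 1 ≤ count P xs
  count-member P x∈xs Px = filter-some (T? ∘ P) (lose x∈xs Px)

  count-concatMap-≥ : (P : B → Bool) (f : A → List B) {K : ℕ} → (∀ x → K ≤ count P (f x)) →
                      (xs : List A) → length xs * K ≤ count P (concatMap f xs)
  count-concatMap-≥ P f K≤ []       = z≤n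
  count-concatMap-≥ P f {K} K≤ (x ∷ xs) = begin
    K + length xs * K                         ≤⟨ +-mono-≤ (K≤ x) (count-concatMap-≥ P f K≤ xs) ⟩
    count P (f x) + count P (concatMap f xs)  ≡⟨ count-++ P (f x) (concatMap f xs) ⟨
    count P (f x ++ concatMap f xs)           ∎
    where open ≤-Reasoning

  count-concatMap : (P : B → Bool) (f : A → List B) {K : ℕ} → (∀ x → count P (f x) ≡ K) →
                    (xs : List A) → count P (concatMap f xs) ≡ length xs * K
  count-concatMap P f fibre []       = refl
  count-concatMap P f fibre (x ∷ xs) =
    trans (count-++ P (f x) (concatMap f xs)) (cong₂ _+_ (fibre x) (count-concatMap P f fibre xs))

  count-filter : (P Q : A → Bool) (xs : List A) → count Q (filterᵇ P xs) ≡ count (λ x → P x ∧ Q x) xs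
  count-filter P Q []       = refl
  count-filter P Q (x ∷ xs) with P x
  ... | false = count-filter P Q xs
  ... | true with Q x
  ...   | true  = cong suc (count-filter P Q xs)
  ...   | false = count-filter P Q xs

  count-tabulate : (P : A → Bool) (f : Fin n → A) → count P (tabulate f) ≡ count (P ∘ f) (allFin n)
  count-tabulate P f = trans (cong (count P) (sym (map-tabulate id f))) (count-map P f (allFin _))

  count-allFin-suc : (P : Fin (suc n) → Bool) →
                     count P (allFin (suc n))
                     ≡ (if P zero then suc (count (P ∘ suc) (allFin n)) else count (P ∘ suc) (allFin n))
  count-allFin-suc {n} P with P zero
  ... | true  = cong suc (count-tabulate P suc)
  ... | false = count-tabulate P suc

  count-≟-allFin : (r : Fin n) → count (λ t → does (t ≟ r)) (allFin n) ≡ 1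
  count-≟-allFin {suc n} zero    =
    cong suc (trans (count-tabulate {n = n} (λ t → does (t ≟ zero)) suc) (count-false (λ _ → refl) (allFin n)))
  count-≟-allFin {suc n} (suc r) = trans (count-tabulate {n = n} (λ t → does (t ≟ suc r)) suc) (count-≟-allFin r)

  ∈-allVecs : {p : ℕ} (v : Vec (Fin p) n) → v ∈ allVecs p n
  ∈-allVecs []      = here refl
  ∈-allVecs {p = p} (x ∷ v) =
    ∈-concatMap⁺ (λ y → map (y ∷_) (allVecs p _)) (lose (∈-allFin x) (∈-map⁺ (x ∷_) (∈-allVecs v)))

  length-allVecs : (p n : ℕ) → length (allVecs p n) ≡ p ^ n
  length-allVecs p zero    = refl
  length-allVecs p (suc n) = begin
    length (allVecs p (suc n))                 ≡⟨ count-true (allVecs p (suc n)) ⟨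
    count (λ _ → true) (allVecs p (suc n))
      ≡⟨ count-concatMap (λ _ → true) (λ x → map (x ∷_) (allVecs p n)) fibre (allFin p) ⟩
    length (allFin p) * p ^ n                  ≡⟨ cong (_* p ^ n) (length-tabulate {n = p} id) ⟩
    p * p ^ n                                  ∎
    where
    open ≡-Reasoning
    fibre : ∀ x → count (λ _ → true) (map (x ∷_) (allVecs p n)) ≡ p ^ n
    fibre x = trans (count-map (λ _ → true) (x ∷_) (allVecs p n))
                    (trans (count-true (allVecs p n)) (length-allVecs p n))

  count-allVecs-∷-≥ : {p : ℕ} (P : Vec (Fin p) (suc n) → Bool) {K : ℕ} →
                      (∀ x → K ≤ count (P ∘ (x ∷_)) (allVecs p n)) → p * K ≤ count P (allVecs p (suc n))
  count-allVecs-∷-≥ {n} {p} P {K} K≤ = begin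
    p * K                        ≡⟨ cong (_* K) (length-tabulate {n = p} id) ⟨
    length (allFin p) * K        ≤⟨ count-concatMap-≥ P (λ x → map (x ∷_) (allVecs p n)) K≤count (allFin p) ⟩
    count P (allVecs p (suc n))  ∎
    where
    open ≤-Reasoning
    K≤count : ∀ x → K ≤ count P (map (x ∷_) (allVecs p n))
    K≤count x = subst (K ≤_) (sym (count-map P (x ∷_) (allVecs p n))) (K≤ x)

  count-allVecs-++-≥ : {p : ℕ} (m : ℕ) (P : Vec (Fin p) (m + n) → Bool) {K : ℕ} →
                       (∀ u → K ≤ count (λ v → P (u Vec.++ v)) (allVecs p n)) →
                       p ^ m * K ≤ count P (allVecs p (m + n))
  count-allVecs-++-≥ {n} {p} zero P {K} K≤ = subst (_≤ count P (allVecs p n)) (sym (+-identityʳ K)) (K≤ [])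
  count-allVecs-++-≥ {n} {p} (suc m) P {K} K≤ = begin
    p * p ^ m * K                    ≡⟨ *-assoc p (p ^ m) K ⟩
    p * (p ^ m * K)                  ≤⟨ count-allVecs-∷-≥ P (λ x → count-allVecs-++-≥ m (P ∘ (x ∷_)) (K≤ ∘ (x ∷_))) ⟩
    count P (allVecs p (suc m + n))  ∎
    where open ≤-Reasoning

  count-allVecs-∷ʳ-≥ : {p : ℕ} (P : Vec (Fin p) (suc n) → Bool) {K : ℕ} →
                       (∀ w → K ≤ count (λ t → P (w ∷ʳ t)) (allFin p)) → p ^ n * K ≤ count P (allVecs p (suc n))
  count-allVecs-∷ʳ-≥ {zero} {p} P {K} K≤ = begin
    K + 0                                 ≡⟨ +-identityʳ K ⟩
    K                                     ≤⟨ K≤ [] ⟩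
    count (λ t → P (t ∷ [])) (allFin p)    ≡⟨ count-map P (_∷ []) (allFin p) ⟨
    count P (map (_∷ []) (allFin p))       ≡⟨ cong (count P) (concatMap-pure (map (_∷ []) (allFin p))) ⟨
    count P (concatMap [_] (map (_∷ []) (allFin p))) ≡⟨ cong (count P) (concatMap-map [_] (_∷ []) (allFin p)) ⟩
    count P (allVecs p 1)                 ∎
    where open ≤-Reasoning
  count-allVecs-∷ʳ-≥ {suc n} {p} P {K} K≤ = begin
    p * p ^ n * K                    ≡⟨ *-assoc p (p ^ n) K ⟩
    p * (p ^ n * K)                  ≤⟨ count-allVecs-∷-≥ P (λ x → count-allVecs-∷ʳ-≥ (P ∘ (x ∷_)) (K≤ ∘ (x ∷_))) ⟩
    count P (allVecs p (suc (suc n))) ∎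
    where open ≤-Reasoning

  module _ (q : ℕ) where

    private
      p : ℕ
      p = suc (suc q)

      one : Fin p
      one = suc zero

      prefixed : (n : ℕ) → Fin p → List (Vec (Fin p) (suc n))
      prefixed n x = map (x ∷_) (allVecs p n)

      -- allVecs p (suc n) unfolds to prefixed n zero ++ (prefixed n one ++ prefixed≥2 n).
      prefixed≥2 : (n : ℕ) → List (Vec (Fin p) (suc n))
      prefixed≥2 n = concatMap (prefixed n) (tabulate (Fin.suc ∘ Fin.suc))

    length-projPoints-suc : (n : ℕ) → length (projPoints p (suc n)) ≡ length (projPoints p n) + p ^ n
    length-projPoints-suc n = begin
      count normalised (prefixed n zero ++ (prefixed n one ++ prefixed≥2 n))
        ≡⟨ count-++ normalised (prefixed n zero) (prefixed n one ++ prefixed≥2 n) ⟩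
      count normalised (prefixed n zero) + count normalised (prefixed n one ++ prefixed≥2 n)
        ≡⟨ cong (count normalised (prefixed n zero) +_) (count-++ normalised (prefixed n one) (prefixed≥2 n)) ⟩
      count normalised (prefixed n zero) + (count normalised (prefixed n one) + count normalised (prefixed≥2 n))
        ≡⟨ cong₂ _+_ (count-map normalised (zero ∷_) (allVecs p n))
                     (cong₂ _+_ (trans (count-map normalised (one ∷_) (allVecs p n))
                                       (trans (count-true (allVecs p n)) (length-allVecs p n)))
                                count-prefixed≥2) ⟩
      count normalised (allVecs p n) + (p ^ n + 0)
        ≡⟨ cong (count normalised (allVecs p n) +_) (+-identityʳ (p ^ n)) ⟩
      length (projPoints p n) + p ^ n ∎
      where
      open ≡-Reasoning
      count-prefixed≥2 : count normalised (prefixed≥2 n) ≡ 0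
      count-prefixed≥2 = begin
        count normalised (concatMap (prefixed n) (tabulate (Fin.suc ∘ Fin.suc)))
          ≡⟨ cong (count normalised ∘ concatMap (prefixed n)) (map-tabulate id (Fin.suc ∘ Fin.suc)) ⟨
        count normalised (concatMap (prefixed n) (map (Fin.suc ∘ Fin.suc) (allFin q)))
          ≡⟨ cong (count normalised) (concatMap-map (prefixed n) (Fin.suc ∘ Fin.suc) (allFin q)) ⟩
        count normalised (concatMap (prefixed n ∘ Fin.suc ∘ Fin.suc) (allFin q))
          ≡⟨ count-concatMap normalised (prefixed n ∘ Fin.suc ∘ Fin.suc)
                             (λ i → count-map normalised (suc (suc i) ∷_) (allVecs p n)) (allFin q) ⟩
        length (allFin q) * count (λ _ → false) (allVecs p n)
          ≡⟨ cong (length (allFin q) *_) (count-false (λ _ → refl) (allVecs p n)) ⟩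
        length (allFin q) * 0
          ≡⟨ *-zeroʳ (length (allFin q)) ⟩
        0 ∎

    length-projPoints-bound : (n : ℕ) → length (projPoints p n) * suc q ≤ p ^ n
    length-projPoints-bound zero    = z≤n
    length-projPoints-bound (suc n) = begin
      length (projPoints p (suc n)) * suc q              ≡⟨ cong (_* suc q) (length-projPoints-suc n) ⟩
      (length (projPoints p n) + p ^ n) * suc q          ≡⟨ *-distribʳ-+ (suc q) (length (projPoints p n)) (p ^ n) ⟩
      length (projPoints p n) * suc q + p ^ n * suc q    ≤⟨ +-monoˡ-≤ (p ^ n * suc q) (length-projPoints-bound n) ⟩
      p ^ n + p ^ n * suc q                              ≡⟨ cong (p ^ n +_) (*-comm (p ^ n) (suc q)) ⟩
      p * p ^ n                                          ∎
      where open ≤-Reasoning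

    projPoints-nonempty : (n : ℕ) → 0 < length (projPoints p (suc n))
    projPoints-nonempty n = count-member normalised (∈-allVecs (one ∷ Vec.replicate n zero)) tt

    count-chart-≤ : (n : ℕ) (Q : Vec (Fin p) (suc n) → Bool) →
                    count (Q ∘ (one ∷_)) (allVecs p n) ≤ count Q (projPoints p (suc n))
    count-chart-≤ n Q = begin
      count (Q ∘ (one ∷_)) (allVecs p n)   ≡⟨ count-map N∧Q (one ∷_) (allVecs p n) ⟨
      count N∧Q (prefixed n one)           ≤⟨ m≤n+m _ (count N∧Q (prefixed n zero)) ⟩
      count N∧Q (prefixed n zero) + count N∧Q (prefixed n one)
        ≤⟨ +-monoʳ-≤ (count N∧Q (prefixed n zero)) (m≤m+n _ (count N∧Q (prefixed≥2 n))) ⟩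
      count N∧Q (prefixed n zero) + (count N∧Q (prefixed n one) + count N∧Q (prefixed≥2 n))
        ≡⟨ cong (count N∧Q (prefixed n zero) +_) (count-++ N∧Q (prefixed n one) (prefixed≥2 n)) ⟨
      count N∧Q (prefixed n zero) + count N∧Q (prefixed n one ++ prefixed≥2 n)
        ≡⟨ count-++ N∧Q (prefixed n zero) (prefixed n one ++ prefixed≥2 n) ⟨
      count N∧Q (allVecs p (suc n))        ≡⟨ count-filter normalised Q (allVecs p (suc n)) ⟨
      count Q (projPoints p (suc n))       ∎
      where
      open ≤-Reasoning
      N∧Q : Vec (Fin p) (suc n) → Bool
      N∧Q v = normalised v ∧ Q v

open Counting

module Determinants where

  open import Data.Bool using (if_then_else_)
  open import Data.Fin using (Fin; zero; suc; toℕ; punchIn)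
  import Data.Fin as Fin
  open import Data.Integer using (ℤ; +_; _+_; _*_; -_)
  open import Data.Integer.Properties using (*-zeroʳ)
  open import Data.List using (List; []; _∷_; allFin; tabulate)
  open import Data.Nat using (ℕ; zero; suc; _<_; z≤n; s≤s)
  open import Data.Nat.Divisibility using (_∣?_)
  open import Function using (_∘_)
  open import Relation.Nullary.Decidable using (⌊_⌋)
  open import Relation.Binary.PropositionalEquality using (_≡_; refl; trans; cong; cong₂; module ≡-Reasoning)

  private variable
    A : Set
    n : ℕ

  ∑ : (A → ℤ) → List A → ℤ
  ∑ f []       = + 0
  ∑ f (x ∷ xs) = f x + ∑ f xs

  ∑-cong : {f g : A → ℤ} → (∀ x → f x ≡ g x) → (xs : List A) → ∑ f xs ≡ ∑ g xs
  ∑-cong f≗g []       = refl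
  ∑-cong f≗g (x ∷ xs) = cong₂ _+_ (f≗g x) (∑-cong f≗g xs)

  ∑-tabulate-≡0 : (g : Fin n → A) (f : A → ℤ) → (∀ j → f (g j) ≡ + 0) → ∑ f (tabulate g) ≡ + 0
  ∑-tabulate-≡0 {zero}  g f f∘g≡0 = refl
  ∑-tabulate-≡0 {suc n} g f f∘g≡0 = cong₂ _+_ (f∘g≡0 zero) (∑-tabulate-≡0 (g ∘ suc) f (f∘g≡0 ∘ suc))

  Matrix : ℕ → Set
  Matrix n = Fin n → Fin n → ℤ

  sign : Fin n → ℤ
  sign j = if ⌊ 2 ∣? toℕ j ⌋ then + 1 else - + 1

  minor : Matrix (suc n) → Fin (suc n) → Matrix n
  minor M j i k = M (suc i) (punchIn j k)

  expansionTerm : Matrix (suc n) → Fin (suc n) → ℤ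
  expansionTerm {n} M j = sign j * M zero j * det n (minor M j)

  -- The list recursion inside det is a local function; abstracting the index list lets
  -- unification identify it with ∑.
  det-expansion : (M : Matrix (suc n)) → det (suc n) M ≡ ∑ (expansionTerm M) (allFin (suc n))
  det-expansion {n} M with tabulate {n = n} (Fin.suc {n}) | recursion-is-∑ _ refl (λ _ _ → refl)
    where
    recursion-is-∑ : (G : List (Fin (suc n)) → ℤ) → G [] ≡ + 0 →
                     (∀ j js → G (j ∷ js) ≡ expansionTerm M j + G js) →
                     ∀ js → G js ≡ ∑ (expansionTerm M) js
    recursion-is-∑ G G[] G∷ []       = G[]
    recursion-is-∑ G G[] G∷ (j ∷ js) = trans (G∷ j js) (cong (λ s → expansionTerm M j + s) (recursion-is-∑ G G[] G∷ js))
  ... | js | go≡∑ = cong (λ s → expansionTerm M zero + s) (go≡∑ js)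

  det-cong : {M N : Matrix n} → (∀ i j → M i j ≡ N i j) → det n M ≡ det n N
  det-cong {zero}          M≗N = refl
  det-cong {suc n} {M} {N} M≗N = begin
    det (suc n) M                      ≡⟨ det-expansion M ⟩
    ∑ (expansionTerm M) (allFin (suc n)) ≡⟨ ∑-cong term≗ (allFin (suc n)) ⟩
    ∑ (expansionTerm N) (allFin (suc n)) ≡⟨ det-expansion N ⟨
    det (suc n) N                      ∎
    where
    open ≡-Reasoning
    term≗ : ∀ j → expansionTerm M j ≡ expansionTerm N j
    term≗ j = cong₂ (λ a d → sign j * a * d) (M≗N zero j) (det-cong (λ i k → M≗N (suc i) (punchIn j k)))

  -- For j ≠ 0 the minor of column j still contains column 0 of M.
  expansionTerm-suc-≡0 : (M : Matrix (suc n)) → (∀ i → M (suc i) zero ≡ + 0) →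
                         ∀ j → expansionTerm M (suc j) ≡ + 0
  det-column₀-≡0 : (M : Matrix (suc n)) → (∀ i → M i zero ≡ + 0) → det (suc n) M ≡ + 0

  expansionTerm-suc-≡0 {suc n} M col₀≡0 j = begin
    sign (suc j) * M zero (suc j) * det (suc n) (minor M (suc j))
      ≡⟨ cong (sign (suc j) * M zero (suc j) *_) (det-column₀-≡0 (minor M (suc j)) col₀≡0) ⟩
    sign (suc j) * M zero (suc j) * + 0
      ≡⟨ *-zeroʳ (sign (suc j) * M zero (suc j)) ⟩
    + 0 ∎
    where open ≡-Reasoning

  det-column₀-≡0 {n} M col₀≡0 = begin
    det (suc n) M                                             ≡⟨ det-expansion M ⟩
    expansionTerm M zero + ∑ (expansionTerm M) (tabulate suc) ≡⟨ cong₂ _+_ term₀≡0 rest≡0 ⟩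
    + 0                                                       ∎
    where
    open ≡-Reasoning
    term₀≡0 : expansionTerm M zero ≡ + 0
    term₀≡0 = cong (λ a → sign {suc n} zero * a * det n (minor M zero)) (col₀≡0 zero)
    rest≡0 : ∑ (expansionTerm M) (tabulate suc) ≡ + 0
    rest≡0 = ∑-tabulate-≡0 suc (expansionTerm M) (expansionTerm-suc-≡0 M (col₀≡0 ∘ suc))

  det-upper-unitriangular : (M : Matrix n) → (∀ i j → toℕ j < toℕ i → M i j ≡ + 0) → (∀ i → M i i ≡ + 1) →
                            det n M ≡ + 1
  det-upper-unitriangular {zero}  M below≡0 diag≡1 = refl
  det-upper-unitriangular {suc n} M below≡0 diag≡1 = begin
    det (suc n) M                                             ≡⟨ det-expansion M ⟩
    expansionTerm M zero + ∑ (expansionTerm M) (tabulate suc) ≡⟨ cong₂ _+_ term₀≡1 rest≡0 ⟩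
    + 1                                                       ∎
    where
    open ≡-Reasoning
    term₀≡1 : expansionTerm M zero ≡ + 1
    term₀≡1 = cong₂ (λ a d → sign {suc n} zero * a * d) (diag≡1 zero)
                    (det-upper-unitriangular (minor M zero) (λ i j j<i → below≡0 (suc i) (suc j) (s≤s j<i)) (diag≡1 ∘ suc))
    rest≡0 : ∑ (expansionTerm M) (tabulate suc) ≡ + 0
    rest≡0 = ∑-tabulate-≡0 suc (expansionTerm M) (expansionTerm-suc-≡0 M (λ i → below≡0 (suc i) zero (s≤s z≤n)))

open Determinants

module Polynomials where

  open import Data.Bool using (Bool; true; false; T; if_then_else_)
  open import Data.Empty using (⊥-elim)
  open import Data.Fin using (Fin; zero; suc; toℕ; punchIn; _≟_)
  open import Data.Fin.Properties using (toℕ-injective; toℕ<n)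
  open import Data.Integer using (ℤ; +_; ∣_∣; _+_; _*_; _-_)
  open import Data.Integer.Properties using (*-zeroʳ; +-identityʳ; +-identityˡ; +-assoc; ∣m⊝n∣≤m⊔n; m-n≡m⊖n; ∣i∣≡0⇒i≡0; i-j≡0⇒i≡j; abs-*; +-injective)
  import Data.Integer.Divisibility.Signed as ℤ∣
  open import Data.Integer.Solver using (module +-*-Solver)
  open import Data.List using (List; []; _∷_; allFin)
  open import Data.Nat as ℕ using (ℕ; zero; suc; _<_; _≤_; z≤n)
  import Data.Nat.Properties as ℕ
  open import Data.Nat.Divisibility using (_∣_; _∣?_; ∣⇒≤)
  open import Data.Nat.Primality using (Prime; euclidsLemma)
  open import Data.Product using (∃; _×_; _,_)
  open import Data.Sum using (_⊎_; inj₁; inj₂)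
  open import Function using (_∘_)
  open import Relation.Nullary using (¬_; does; yes; no)
  open import Relation.Nullary.Decidable using (⌊_⌋; toWitness; fromWitness; dec-true)
  open import Relation.Binary.PropositionalEquality using (_≡_; refl; sym; trans; cong; cong₂; subst; module ≡-Reasoning)

  open +-*-Solver

  private variable
    A : Set
    n k : ℕ

  -- f is a polynomial function of degree ≤ k with tᵏ-coefficient c, in Horner form
  -- f t = a₀ + t * (a₁ + t * (⋯ + t * c)).
  data IsPolynomial : ℕ → (ℤ → ℤ) → ℤ → Set where
    constant : {f : ℤ → ℤ} {c : ℤ} → (∀ t → f t ≡ c) → IsPolynomial 0 f c
    horner   : {f g : ℤ → ℤ} {c : ℤ} (a : ℤ) → IsPolynomial k g c → (∀ t → f t ≡ a + t * g t) →
               IsPolynomial (suc k) f c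

  IsPolynomial-cong : {f g : ℤ → ℤ} {c d : ℤ} → (∀ t → f t ≡ g t) → c ≡ d → IsPolynomial k f c → IsPolynomial k g d
  IsPolynomial-cong f≗g refl (constant f≗c)     = constant (λ t → trans (sym (f≗g t)) (f≗c t))
  IsPolynomial-cong f≗g refl (horner a g f≗a+tg) = horner a g (λ t → trans (sym (f≗g t)) (f≗a+tg t))

  IsPolynomial-zero : IsPolynomial k (λ _ → + 0) (+ 0)
  IsPolynomial-zero {zero}  = constant (λ _ → refl)
  IsPolynomial-zero {suc k} = horner (+ 0) IsPolynomial-zero (λ t → sym (trans (+-identityˡ (t * + 0)) (*-zeroʳ t)))

  IsPolynomial-+ : {f g : ℤ → ℤ} {c d : ℤ} → IsPolynomial k f c → IsPolynomial k g d →
                   IsPolynomial k (λ t → f t + g t) (c + d)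
  IsPolynomial-+ (constant f≗c) (constant g≗d) = constant (λ t → cong₂ _+_ (f≗c t) (g≗d t))
  IsPolynomial-+ (horner a f′ f≗) (horner b g′ g≗) =
    horner (a + b) (IsPolynomial-+ f′ g′) (λ t → trans (cong₂ _+_ (f≗ t) (g≗ t)) (sum-of-horner a b t _ _))
    where
    sum-of-horner : ∀ a b t x y → (a + t * x) + (b + t * y) ≡ (a + b) + t * (x + y)
    sum-of-horner = solve 5 (λ a b t x y → (a :+ t :* x) :+ (b :+ t :* y) := (a :+ b) :+ t :* (x :+ y)) refl

  IsPolynomial-scale : {f : ℤ → ℤ} {c : ℤ} (s : ℤ) → IsPolynomial k f c → IsPolynomial k (λ t → s * f t) (s * c)
  IsPolynomial-scale s (constant f≗c)     = constant (λ t → cong (s *_) (f≗c t))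
  IsPolynomial-scale s (horner a g f≗a+tg) =
    horner (s * a) (IsPolynomial-scale s g) (λ t → trans (cong (s *_) (f≗a+tg t)) (scaled-horner s a t _))
    where
    scaled-horner : ∀ s a t x → s * (a + t * x) ≡ s * a + t * (s * x)
    scaled-horner = solve 4 (λ s a t x → s :* (a :+ t :* x) := s :* a :+ t :* (s :* x)) refl

  IsPolynomial-lift : {f : ℤ → ℤ} {c : ℤ} → IsPolynomial k f c → IsPolynomial (suc k) f (+ 0)
  IsPolynomial-lift {c = c} (constant f≗c) =
    horner c IsPolynomial-zero (λ t → trans (f≗c t) (sym (trans (cong (λ x → c + x) (*-zeroʳ t)) (+-identityʳ c))))
  IsPolynomial-lift (horner a g f≗a+tg)   = horner a (IsPolynomial-lift g) f≗a+tg

  IsPolynomial-affine-* : {f : ℤ → ℤ} {c : ℤ} (α β : ℤ) → IsPolynomial k f c →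
                          IsPolynomial (suc k) (λ t → (α + t * β) * f t) (β * c)
  IsPolynomial-affine-* {f = f} α β f-poly =
    IsPolynomial-cong expand (+-identityˡ _)
      (IsPolynomial-+ (IsPolynomial-lift (IsPolynomial-scale α f-poly))
                      (horner (+ 0) (IsPolynomial-scale β f-poly) (λ _ → refl)))
    where
    expand : ∀ t → α * f t + (+ 0 + t * (β * f t)) ≡ (α + t * β) * f t
    expand t = solve 4 (λ α β t x → α :* x :+ (con (+ 0) :+ t :* (β :* x)) := (α :+ t :* β) :* x) refl α β t (f t)

  IsPolynomial-∑ : {F : A → ℤ → ℤ} {c : A → ℤ} → (∀ x → IsPolynomial k (F x) (c x)) →
                   (xs : List A) → IsPolynomial k (λ t → ∑ (λ x → F x t) xs) (∑ c xs)
  IsPolynomial-∑ F-poly []       = IsPolynomial-zero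
  IsPolynomial-∑ F-poly (x ∷ xs) = IsPolynomial-+ (F-poly x) (IsPolynomial-∑ F-poly xs)

  difference-quotient : {g : ℤ → ℤ} {c : ℤ} → IsPolynomial k g c → (r : ℤ) →
                        ∃ λ q → IsPolynomial k q c × (∀ t → t * g t ≡ r * g r + (t - r) * q t)
  difference-quotient {g = g} {c} (constant g≗c) r = (λ _ → c) , constant (λ _ → refl) , λ t → begin
    t * g t               ≡⟨ cong (t *_) (g≗c t) ⟩
    t * c                 ≡⟨ solve 3 (λ t r c → t :* c := r :* c :+ (t :- r) :* c) refl t r c ⟩
    r * c + (t - r) * c   ≡⟨ cong (λ x → r * x + (t - r) * c) (g≗c r) ⟨
    r * g r + (t - r) * c ∎
    where open ≡-Reasoning
  difference-quotient {g = g} (horner {g = h} a h-poly g≗) r with difference-quotient h-poly r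
  ... | qh , qh-poly , th≡ = q , horner (a + r * h r) qh-poly (λ _ → refl) , λ t → begin
    t * g t                                 ≡⟨ cong (t *_) (g≗ t) ⟩
    t * (a + t * h t)                       ≡⟨ cong (λ x → t * (a + x)) (th≡ t) ⟩
    t * (a + (r * h r + (t - r) * qh t))    ≡⟨ regroup t r a (h r) (qh t) ⟩
    r * (a + r * h r) + (t - r) * q t       ≡⟨ cong (λ x → r * x + (t - r) * q t) (g≗ r) ⟨
    r * g r + (t - r) * q t                 ∎
    where
    open ≡-Reasoning
    q : ℤ → ℤ
    q t = (a + r * h r) + t * qh t
    regroup : ∀ t r a H Q → t * (a + (r * H + (t - r) * Q)) ≡ r * (a + r * H) + (t - r) * ((a + r * H) + t * Q)
    regroup = solve 5 (λ t r a H Q → t :* (a :+ (r :* H :+ (t :- r) :* Q))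
                                   := r :* (a :+ r :* H) :+ (t :- r) :* ((a :+ r :* H) :+ t :* Q)) refl

  remainder-theorem : {f : ℤ → ℤ} {c : ℤ} → IsPolynomial (suc k) f c → (r : ℤ) →
                      ∃ λ q → IsPolynomial k q c × (∀ t → f t ≡ f r + (t - r) * q t)
  remainder-theorem {f = f} (horner {g = g} a g-poly f≗) r with difference-quotient g-poly r
  ... | q , q-poly , tg≡ = q , q-poly , λ t → begin
    f t                               ≡⟨ f≗ t ⟩
    a + t * g t                       ≡⟨ cong (λ x → a + x) (tg≡ t) ⟩
    a + (r * g r + (t - r) * q t)     ≡⟨ +-assoc a (r * g r) ((t - r) * q t) ⟨
    (a + r * g r) + (t - r) * q t     ≡⟨ cong (λ x → x + (t - r) * q t) (f≗ r) ⟨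
    f r + (t - r) * q t               ∎
    where open ≡-Reasoning

  isRoot : (p : ℕ) → (ℤ → ℤ) → Fin p → Bool
  isRoot p f t = ⌊ p ∣? ∣ f (+ toℕ t) ∣ ⌋

  ∣-difference⇒≡ : {p : ℕ} (t r : Fin p) → p ∣ ∣ + toℕ t - + toℕ r ∣ → t ≡ r
  ∣-difference⇒≡ {p} t r p∣t-r =
    toℕ-injective (+-injective (i-j≡0⇒i≡j _ _ (∣i∣≡0⇒i≡0 (small-multiple-≡0 ∣t-r∣<p p∣t-r))))
    where
    ∣t-r∣<p : ∣ + toℕ t - + toℕ r ∣ < p
    ∣t-r∣<p = subst (_< p) (sym (cong ∣_∣ (m-n≡m⊖n (toℕ t) (toℕ r))))
                    (ℕ.≤-<-trans (∣m⊝n∣≤m⊔n (toℕ t) (toℕ r)) (ℕ.⊔-lub (toℕ<n t) (toℕ<n r)))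
    small-multiple-≡0 : ∀ {x} → x < p → p ∣ x → x ≡ 0
    small-multiple-≡0 {zero}  _   _   = refl
    small-multiple-≡0 {suc x} x<p p∣x = ⊥-elim (ℕ.<⇒≱ x<p (∣⇒≤ p∣x))

  -- p divides f t − f r = (t − r) q t, and p is prime.
  root-split : {p : ℕ} → Prime p → {f q : ℤ → ℤ} (r : Fin p) →
               (∀ t → f t ≡ f (+ toℕ r) + (t - + toℕ r) * q t) → T (isRoot p f r) →
               ∀ t → T (isRoot p f t) → T (does (t ≟ r)) ⊎ T (isRoot p q t)
  root-split {p} p-prime {f} {q} r f≡ r-root t t-root
    with euclidsLemma ∣ T′ - R ∣ ∣ q T′ ∣ p-prime p∣product
    where
    T′ R : ℤ
    T′ = + toℕ t
    R  = + toℕ r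
    p∣fR+[T-R]qT : + p ℤ∣.∣ f R + (T′ - R) * q T′
    p∣fR+[T-R]qT = subst (+ p ℤ∣.∣_) (f≡ T′) (ℤ∣.∣ᵤ⇒∣ {i = f T′} (toWitness t-root))
    p∣product : p ∣ ∣ T′ - R ∣ ℕ.* ∣ q T′ ∣
    p∣product = subst (p ∣_) (abs-* (T′ - R) (q T′))
      (ℤ∣.∣⇒∣ᵤ (ℤ∣.∣m+n∣m⇒∣n {m = f R} p∣fR+[T-R]qT (ℤ∣.∣ᵤ⇒∣ {i = f R} (toWitness r-root))))
  ... | inj₁ p∣t-r = inj₁ (subst T (sym (dec-true (t ≟ r) (∣-difference⇒≡ t r p∣t-r))) _)
  ... | inj₂ p∣qt  = inj₂ (fromWitness p∣qt)

  count-roots-≤ : {p : ℕ} → Prime p → {f : ℤ → ℤ} {c : ℤ} → IsPolynomial k f c → ¬ p ∣ ∣ c ∣ →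
                  count (isRoot p f) (allFin p) ≤ k
  count-roots-≤ {p = p} p-prime {f} (constant f≗c) p∤c = ℕ.≤-reflexive (count-false no-root (allFin p))
    where
    no-root : ∀ t → isRoot p f t ≡ false
    no-root t with p ∣? ∣ f (+ toℕ t) ∣
    ... | yes p∣ft = ⊥-elim (p∤c (subst (λ x → p ∣ ∣ x ∣) (f≗c (+ toℕ t)) p∣ft))
    ... | no  _    = refl
  count-roots-≤ {suc k} {p} p-prime {f} f-poly p∤c with count-≡0⊎witness (isRoot p f) (allFin p)
  ... | inj₁ no-roots = subst (_≤ suc k) (sym no-roots) z≤n
  ... | inj₂ (r , r-root) with remainder-theorem f-poly (+ toℕ r)
  ...   | q , q-poly , f≡ = begin
    count (isRoot p f) (allFin p)
      ≤⟨ count-∪ (root-split p-prime r f≡ r-root) (allFin p) ⟩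
    count (λ t → does (t ≟ r)) (allFin p) ℕ.+ count (isRoot p q) (allFin p)
      ≤⟨ ℕ.+-mono-≤ (ℕ.≤-reflexive (count-≟-allFin r)) (count-roots-≤ p-prime q-poly p∤c) ⟩
    suc k ∎
    where open ℕ.≤-Reasoning

  pencil : Matrix n → Matrix n → ℤ → Matrix n
  pencil A B t i j = A i j + t * B i j

  selectRows : (Fin n → Bool) → Matrix n → Matrix n → Matrix n
  selectRows S A B i j = if S i then B i j else A i j

  selectRows-unselected : {S : Fin n → Bool} {A B : Matrix n} {i : Fin n} → S i ≡ false →
                          ∀ j → selectRows S A B i j ≡ A i j
  selectRows-unselected {S = S} {A} {B} {i} Si≡false j = cong (λ b → if b then B i j else A i j) Si≡false

  selectRows-selected : {S : Fin n → Bool} {A B : Matrix n} {i : Fin n} → S i ≡ true →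
                        ∀ j → selectRows S A B i j ≡ B i j
  selectRows-selected {S = S} {A} {B} {i} Si≡true j = cong (λ b → if b then B i j else A i j) Si≡true

  -- Expanding along the first row, each selected row contributes one factor linear in t.
  det-pencil : (S : Fin n → Bool) (A B : Matrix n) → (∀ i j → S i ≡ false → B i j ≡ + 0) →
               IsPolynomial (count S (allFin n)) (λ t → det n (pencil A B t)) (det n (selectRows S A B))
  det-pencil {zero}  S A B B≡0 = constant (λ _ → refl)
  det-pencil {suc n} S A B B≡0 =
    subst (λ m → IsPolynomial m (λ t → det (suc n) (pencil A B t)) (det (suc n) (selectRows S A B)))
          (sym (count-allFin-suc S))
          (IsPolynomial-cong (λ t → sym (det-expansion (pencil A B t))) (sym (det-expansion (selectRows S A B)))
                             (IsPolynomial-∑ term-poly (allFin (suc n))))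
    where
    m : ℕ
    m = count (S ∘ suc) (allFin n)
    minor-poly : ∀ j → IsPolynomial m (λ t → det n (pencil (minor A j) (minor B j) t))
                                      (det n (selectRows (S ∘ suc) (minor A j) (minor B j)))
    minor-poly j = det-pencil (S ∘ suc) (minor A j) (minor B j) (λ i l → B≡0 (suc i) (punchIn j l))
    term-poly : ∀ j → IsPolynomial (if S zero then suc m else m)
                                   (λ t → expansionTerm (pencil A B t) j) (expansionTerm (selectRows S A B) j)
    term-poly j with S zero in S₀
    ... | true  = IsPolynomial-cong (λ t → sym (affine-term t)) refl
                    (IsPolynomial-affine-* (sign j * A zero j) (sign j * B zero j) (minor-poly j))
      where
      affine-term : ∀ t → sign j * (A zero j + t * B zero j) * det n (pencil (minor A j) (minor B j) t)
                        ≡ (sign j * A zero j + t * (sign j * B zero j)) * det n (pencil (minor A j) (minor B j) t)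
      affine-term t = solve 5 (λ s a b t D → s :* (a :+ t :* b) :* D := (s :* a :+ t :* (s :* b)) :* D) refl
                        (sign j) (A zero j) (B zero j) t (det n (pencil (minor A j) (minor B j) t))
    ... | false = IsPolynomial-cong (λ t → sym (constant-term t)) refl
                    (IsPolynomial-scale (sign j * A zero j) (minor-poly j))
      where
      constant-term : ∀ t → sign j * (A zero j + t * B zero j) * det n (pencil (minor A j) (minor B j) t)
                          ≡ sign j * A zero j * det n (pencil (minor A j) (minor B j) t)
      constant-term t = trans (cong (λ b → sign j * (A zero j + t * b) * D) (B≡0 zero j S₀))
                              (solve 4 (λ s a t D → s :* (a :+ t :* con (+ 0)) :* D := s :* a :* D) refl
                                       (sign j) (A zero j) t D)
        where
        D = det n (pencil (minor A j) (minor B j) t)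

open Polynomials

module Sylvester where

  open import Data.Bool using (Bool; true; false; not; T; if_then_else_; _∧_)
  open import Data.Empty using (⊥-elim)
  open import Data.Fin using (Fin; zero; suc; toℕ)
  open import Data.Integer using (ℤ; +_; _+_; _*_; ∣_∣)
  open import Data.Integer.Properties using (*-zeroʳ; *-identityʳ; *-identityˡ; +-identityʳ; +-identityˡ)
  open import Data.List using (allFin; length)
  open import Data.List.Properties using (length-tabulate)
  open import Data.Nat as ℕ using (ℕ; zero; suc; _≤_; _<_; _≤ᵇ_; _≡ᵇ_; _∸_; z≤n; s≤s)
  import Data.Nat.Properties as ℕ
  open import Data.Nat.Divisibility using (_∣_; _∣?_; ∣1⇒≡1)
  open import Data.Nat.Primality using (Prime)
  open import Data.Product using (_×_; _,_)
  open import Data.Sum using (_⊎_; inj₁; inj₂)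
  open import Data.Unit using (tt)
  open import Data.Vec using (Vec; []; _∷_; _∷ʳ_; _++_)
  import Data.Vec as Vec
  open import Function using (id; _∘_)
  open import Relation.Nullary using (¬_; yes; no)
  open import Relation.Nullary.Decidable using (⌊_⌋)
  open import Relation.Binary.PropositionalEquality using (_≡_; _≢_; refl; sym; trans; cong; subst; module ≡-Reasoning)


  private variable
    d m n : ℕ

  private
    ≤ᵇ-true⇒≤ : ∀ {m n} → (m ≤ᵇ n) ≡ true → m ≤ n
    ≤ᵇ-true⇒≤ {m} {n} eq = ℕ.≤ᵇ⇒≤ m n (subst T (sym eq) tt)

    ≤ᵇ-false⇒> : ∀ {m n} → (m ≤ᵇ n) ≡ false → n < m
    ≤ᵇ-false⇒> eq = ℕ.≰⇒> (λ m≤n → subst T eq (ℕ.≤⇒≤ᵇ m≤n))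

    ≤⇒≤ᵇ-true : ∀ {m n} → m ≤ n → (m ≤ᵇ n) ≡ true
    ≤⇒≤ᵇ-true {m} {n} m≤n with m ≤ᵇ n in eq
    ... | true  = refl
    ... | false = ⊥-elim (ℕ.<⇒≱ (≤ᵇ-false⇒> eq) m≤n)

    >⇒≤ᵇ-false : ∀ {m n} → n < m → (m ≤ᵇ n) ≡ false
    >⇒≤ᵇ-false {m} {n} n<m with m ≤ᵇ n in eq
    ... | true  = ⊥-elim (ℕ.<⇒≱ n<m (≤ᵇ-true⇒≤ eq))
    ... | false = refl

    x+t*0≡x : ∀ x t → x + t * + 0 ≡ x
    x+t*0≡x x t = trans (cong (λ y → x + y) (*-zeroʳ t)) (+-identityʳ x)

  δ : ℕ → ℕ → ℤ
  δ n k = if n ≡ᵇ k then + 1 else + 0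

  δ-diag : ∀ n → δ n n ≡ + 1
  δ-diag zero    = refl
  δ-diag (suc n) = δ-diag n

  δ-> : ∀ {n k} → k < n → δ n k ≡ + 0
  δ-> {n} {k} k<n with n ≡ᵇ k in eq
  ... | true  = ⊥-elim (ℕ.<⇒≢ k<n (sym (ℕ.≡ᵇ⇒≡ n k (subst T (sym eq) tt))))
  ... | false = refl

  band : ℕ → (ℕ → ℤ) → ℕ → ℕ → ℤ
  band d a s j = if (s ≤ᵇ j) ∧ (j ∸ s ≤ᵇ d) then a (j ∸ s) else + 0

  band-cong : {a b : ℕ → ℤ} → (∀ k → a k ≡ b k) → ∀ s j → band d a s j ≡ band d b s j
  band-cong {d} a≗b s j with (s ≤ᵇ j) ∧ (j ∸ s ≤ᵇ d)
  ... | true  = a≗b (j ∸ s)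
  ... | false = refl

  band-linear : (a b : ℕ → ℤ) (t : ℤ) → ∀ s j → band d (λ k → a k + t * b k) s j ≡ band d a s j + t * band d b s j
  band-linear {d} a b t s j with (s ≤ᵇ j) ∧ (j ∸ s ≤ᵇ d)
  ... | true  = refl
  ... | false = sym (x+t*0≡x (+ 0) t)

  band-≡0 : {a : ℕ → ℤ} → (∀ k → k ≤ d → a k ≡ + 0) → ∀ s j → band d a s j ≡ + 0
  band-≡0 {d} a≡0 s j with s ≤ᵇ j | j ∸ s ≤ᵇ d in j-s≤d
  ... | false | _     = refl
  ... | true  | false = refl
  ... | true  | true  = a≡0 (j ∸ s) (≤ᵇ-true⇒≤ j-s≤d)

  band-below : {a : ℕ → ℤ} → (∀ k → k < m → a k ≡ + 0) → ∀ {s j} → j < s ℕ.+ m → band d a s j ≡ + 0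
  band-below {m} {d} a≡0 {s} {j} j<s+m with s ≤ᵇ j in s≤j | j ∸ s ≤ᵇ d
  ... | false | _     = refl
  ... | true  | false = refl
  ... | true  | true  =
    a≡0 (j ∸ s) (subst (j ∸ s <_) (ℕ.m+n∸m≡n s m) (ℕ.∸-monoˡ-< {n = s} j<s+m (≤ᵇ-true⇒≤ s≤j)))

  band-at : (a : ℕ → ℤ) → ∀ s {k} → k ≤ d → band d a s (s ℕ.+ k) ≡ a k
  band-at a s {k} k≤d rewrite ℕ.m+n∸m≡n s k | ≤⇒≤ᵇ-true (ℕ.m≤m+n s k) | ≤⇒≤ᵇ-true k≤d = refl

  rowShift rowOffset : (d : ℕ) → Fin (d ℕ.+ d) → ℕ
  rowShift  d r = if suc (toℕ r) ≤ᵇ d then toℕ r else toℕ r ∸ d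
  rowOffset d r = if suc (toℕ r) ≤ᵇ d then 0 else suc d

  -- sylvester d v is definitionally sylvesterMatrix d (nth v): rows r < d carry the band of
  -- x₀ … x_d starting in column r, rows d + i the band of y₀ … y_d starting in column i.
  sylvesterMatrix : (d : ℕ) → (ℕ → ℤ) → Matrix (d ℕ.+ d)
  sylvesterMatrix d a r c = band d (λ k → a (rowOffset d r ℕ.+ k)) (rowShift d r) (toℕ c)

  isGRow : (d : ℕ) → Fin (d ℕ.+ d) → Bool
  isGRow d r = not (suc (toℕ r) ≤ᵇ d)

  row-cases : (r : Fin (d ℕ.+ d)) → (toℕ r < d × isGRow d r ≡ false) ⊎ (d ≤ toℕ r × isGRow d r ≡ true)
  row-cases {d} r with suc (toℕ r) ≤ᵇ d in isF
  ... | true  = inj₁ (≤ᵇ-true⇒≤ isF , refl)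
  ... | false = inj₂ (ℕ.≤-pred (≤ᵇ-false⇒> isF) , refl)

  sylvesterMatrix-fRow : (a : ℕ → ℤ) {r c : Fin (d ℕ.+ d)} → toℕ r < d →
                         sylvesterMatrix d a r c ≡ band d a (toℕ r) (toℕ c)
  sylvesterMatrix-fRow a r<d rewrite ≤⇒≤ᵇ-true r<d = refl

  sylvesterMatrix-gRow : (a : ℕ → ℤ) {r c : Fin (d ℕ.+ d)} → d ≤ toℕ r →
                         sylvesterMatrix d a r c ≡ band d (λ k → a (suc d ℕ.+ k)) (toℕ r ∸ d) (toℕ c)
  sylvesterMatrix-gRow a d≤r rewrite >⇒≤ᵇ-false (s≤s d≤r) = refl

  sylvesterMatrix-pencil : {a a₀ b : ℕ → ℤ} (t : ℤ) → (∀ k → a k ≡ a₀ k + t * b k) →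
                           ∀ r c → sylvesterMatrix d a r c ≡ pencil (sylvesterMatrix d a₀) (sylvesterMatrix d b) t r c
  sylvesterMatrix-pencil {d} {a₀ = a₀} {b} t a≡ r c =
    trans (band-cong (λ k → a≡ (rowOffset d r ℕ.+ k)) (rowShift d r) (toℕ c))
          (band-linear (λ k → a₀ (rowOffset d r ℕ.+ k)) (λ k → b (rowOffset d r ℕ.+ k)) t (rowShift d r) (toℕ c))

  -- The Sylvester matrix is affine in y_d with this slope: the coefficient sequence of (f, g) = (0, Xᵈ).
  sylvester-∂yd : (d : ℕ) → Matrix (d ℕ.+ d)
  sylvester-∂yd d = sylvesterMatrix d (δ (suc (d ℕ.+ d)))

  sylvester-∂yd-fRow : ∀ r c → isGRow d r ≡ false → sylvester-∂yd d r c ≡ + 0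
  sylvester-∂yd-fRow {d} r c fRow with row-cases {d} r
  ... | inj₂ (_ , gRow)  = ⊥-elim (subst T (trans (sym gRow) fRow) tt)
  ... | inj₁ (r<d , _)   = trans (sylvesterMatrix-fRow {d} (δ (suc (d ℕ.+ d))) {r} {c} r<d)
                                 (band-≡0 {d} (λ k k≤d → δ-> (s≤s (ℕ.≤-trans k≤d (ℕ.m≤m+n d d)))) (toℕ r) (toℕ c))

  det-sylvester-leading≡1 : (a : ℕ → ℤ) → a 0 ≡ + 1 →
                            det (d ℕ.+ d) (selectRows (isGRow d) (sylvesterMatrix d a) (sylvester-∂yd d)) ≡ + 1
  det-sylvester-leading≡1 {d} a a₀≡1 = det-upper-unitriangular N below≡0 diagonal≡1
    where
    N = selectRows (isGRow d) (sylvesterMatrix d a) (sylvester-∂yd d)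
    N-unselected = selectRows-unselected {S = isGRow d} {sylvesterMatrix d a} {sylvester-∂yd d}
    N-selected   = selectRows-selected {S = isGRow d} {sylvesterMatrix d a} {sylvester-∂yd d}
    yd : ℕ → ℤ
    yd k = δ (suc (d ℕ.+ d)) (suc d ℕ.+ k)
    yd-below : ∀ k → k < d → yd k ≡ + 0
    yd-below k k<d = δ-> (ℕ.+-monoʳ-< d k<d)
    below≡0 : ∀ r c → toℕ c < toℕ r → N r c ≡ + 0
    below≡0 r c c<r with row-cases {d} r
    ... | inj₁ (r<d , fRow) = begin
      N r c                          ≡⟨ N-unselected fRow c ⟩
      sylvesterMatrix d a r c        ≡⟨ sylvesterMatrix-fRow {d} a {r} {c} r<d ⟩
      band d a (toℕ r) (toℕ c)
        ≡⟨ band-below {0} {a = a} (λ _ ()) (subst (toℕ c <_) (sym (ℕ.+-identityʳ (toℕ r))) c<r) ⟩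
      + 0                            ∎
      where open ≡-Reasoning
    ... | inj₂ (d≤r , gRow) = begin
      N r c                                 ≡⟨ N-selected gRow c ⟩
      sylvester-∂yd d r c                   ≡⟨ sylvesterMatrix-gRow {d} (δ (suc (d ℕ.+ d))) {r} {c} d≤r ⟩
      band d yd (toℕ r ∸ d) (toℕ c)         ≡⟨ band-below yd-below (subst (toℕ c <_) (sym (ℕ.m∸n+n≡m d≤r)) c<r) ⟩
      + 0                                   ∎
      where open ≡-Reasoning
    diagonal≡1 : ∀ r → N r r ≡ + 1
    diagonal≡1 r with row-cases {d} r
    ... | inj₁ (r<d , fRow) = begin
      N r r                                ≡⟨ N-unselected fRow r ⟩
      sylvesterMatrix d a r r              ≡⟨ sylvesterMatrix-fRow {d} a {r} {r} r<d ⟩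
      band d a (toℕ r) (toℕ r)             ≡⟨ cong (band d a (toℕ r)) (ℕ.+-identityʳ (toℕ r)) ⟨
      band d a (toℕ r) (toℕ r ℕ.+ 0)       ≡⟨ band-at a (toℕ r) z≤n ⟩
      a 0                                  ≡⟨ a₀≡1 ⟩
      + 1                                  ∎
      where open ≡-Reasoning
    ... | inj₂ (d≤r , gRow) = begin
      N r r                                ≡⟨ N-selected gRow r ⟩
      sylvester-∂yd d r r                  ≡⟨ sylvesterMatrix-gRow {d} (δ (suc (d ℕ.+ d))) {r} {r} d≤r ⟩
      band d yd (toℕ r ∸ d) (toℕ r)        ≡⟨ cong (band d yd (toℕ r ∸ d)) (ℕ.m∸n+n≡m d≤r) ⟨
      band d yd (toℕ r ∸ d) (toℕ r ∸ d ℕ.+ d) ≡⟨ band-at yd (toℕ r ∸ d) ℕ.≤-refl ⟩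
      yd d                                 ≡⟨ δ-diag (suc (d ℕ.+ d)) ⟩
      + 1                                  ∎
      where open ≡-Reasoning

  nth-∷ʳ : {p : ℕ} (w : Vec (Fin p) n) (t : Fin p) (k : ℕ) → nth (w ∷ʳ t) k ≡ nth w k + + toℕ t * δ n k
  nth-∷ʳ []      t zero    = sym (trans (+-identityˡ _) (*-identityʳ (+ toℕ t)))
  nth-∷ʳ []      t (suc k) = sym (x+t*0≡x (+ 0) (+ toℕ t))
  nth-∷ʳ (x ∷ w) t zero    = sym (x+t*0≡x (+ toℕ x) (+ toℕ t))
  nth-∷ʳ (x ∷ w) t (suc k) = nth-∷ʳ w t k

  nth-++-∷ʳ : {p : ℕ} (u : Vec (Fin p) m) (w : Vec (Fin p) n) (t : Fin p) (k : ℕ) →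
              nth (u ++ (w ∷ʳ t)) k ≡ nth (u ++ w) k + + toℕ t * δ (m ℕ.+ n) k
  nth-++-∷ʳ []      w t k       = nth-∷ʳ w t k
  nth-++-∷ʳ (x ∷ u) w t zero    = sym (x+t*0≡x (+ toℕ x) (+ toℕ t))
  nth-++-∷ʳ (x ∷ u) w t (suc k) = nth-++-∷ʳ u w t k

  nth-++ʳ : {p : ℕ} (u : Vec (Fin p) m) (v : Vec (Fin p) n) (k : ℕ) → nth (u ++ v) (m ℕ.+ k) ≡ nth v k
  nth-++ʳ []      v k = refl
  nth-++ʳ (x ∷ u) v k = nth-++ʳ u v k

  nth-replicate-zero : {p : ℕ} (n k : ℕ) → nth (Vec.replicate n (zero {p})) k ≡ + 0
  nth-replicate-zero zero    k       = refl
  nth-replicate-zero (suc n) zero    = refl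
  nth-replicate-zero (suc n) (suc k) = nth-replicate-zero n k

  resultant-pencil : {p : ℕ} (x : Fin p) (u w : Vec (Fin p) d) (t : Fin p) →
                     resultant d (x ∷ u ++ (w ∷ʳ t))
                     ≡ det (d ℕ.+ d) (pencil (sylvesterMatrix d (nth (x ∷ u ++ w))) (sylvester-∂yd d) (+ toℕ t))
  resultant-pencil {d = d} x u w t =
    det-cong (sylvesterMatrix-pencil {d} {nth (x ∷ u ++ (w ∷ʳ t))} {nth (x ∷ u ++ w)} {δ (suc (d ℕ.+ d))}
                                     (+ toℕ t) (nth-++-∷ʳ (x ∷ u) w t))

  count-isGRow : (d : ℕ) → count (isGRow d) (allFin (d ℕ.+ d)) ≡ d
  count-isGRow d = rows-from d
    where
    rows-from : ∀ a {b} → count (λ (r : Fin (a ℕ.+ b)) → not (suc (toℕ r) ≤ᵇ a)) (allFin (a ℕ.+ b)) ≡ b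
    rows-from zero    {b} = trans (count-true (allFin b)) (length-tabulate {n = b} id)
    rows-from (suc a) {b} = trans (count-allFin-suc {a ℕ.+ b} (λ r → not (suc (toℕ r) ≤ᵇ suc a))) (rows-from a)

  det-sylvester-pencil-monic : (a : ℕ → ℤ) → a 0 ≡ + 1 →
                               IsPolynomial d (λ t → det (d ℕ.+ d) (pencil (sylvesterMatrix d a) (sylvester-∂yd d) t)) (+ 1)
  det-sylvester-pencil-monic {d} a a₀≡1 =
    subst (λ k → IsPolynomial k (λ t → det (d ℕ.+ d) (pencil (sylvesterMatrix d a) (sylvester-∂yd d) t)) (+ 1))
          (count-isGRow d)
          (IsPolynomial-cong (λ _ → refl) (det-sylvester-leading≡1 {d} a a₀≡1)
                             (det-pencil (isGRow d) (sylvesterMatrix d a) (sylvester-∂yd d) (sylvester-∂yd-fRow {d})))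

  module _ {q : ℕ} where

    private
      p : ℕ
      p = suc (suc q)

      one : Fin p
      one = suc zero

      p∤1 : ¬ p ∣ 1
      p∤1 p∣1 with ∣1⇒≡1 p∣1
      ... | ()

    count-good-yd-≥ : Prime p → (u w : Vec (Fin p) d) →
                      p ∸ d ≤ count (λ t → resNonzero p d (one ∷ u ++ (w ∷ʳ t))) (allFin p)
    count-good-yd-≥ {d} p-prime u w = begin
      p ∸ d
        ≤⟨ ℕ.∸-monoʳ-≤ p (count-roots-≤ p-prime (det-sylvester-pencil-monic {d} (nth (one ∷ u ++ w)) refl) p∤1) ⟩
      p ∸ count (isRoot p f) (allFin p)
        ≡⟨ cong (_∸ count (isRoot p f) (allFin p)) (length-tabulate {n = p} id) ⟨
      length (allFin p) ∸ count (isRoot p f) (allFin p)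
        ≡⟨ count-not (isRoot p f) (allFin p) ⟨
      count (not ∘ isRoot p f) (allFin p)
        ≡⟨ count-cong (λ t → cong (λ z → not ⌊ p ∣? ∣ z ∣ ⌋) (sym (resultant-pencil one u w t))) (allFin p) ⟩
      count (λ t → resNonzero p d (one ∷ u ++ (w ∷ʳ t))) (allFin p) ∎
      where
      open ℕ.≤-Reasoning
      f : ℤ → ℤ
      f = λ t → det (d ℕ.+ d) (pencil (sylvesterMatrix d (nth (one ∷ u ++ w))) (sylvester-∂yd d) t)

    resNonzero-g≡Xᵈ : (u : Vec (Fin p) d) → resNonzero p d (one ∷ u ++ (Vec.replicate d zero ∷ʳ one)) ≡ true
    resNonzero-g≡Xᵈ {d} u = trans (cong (λ z → not ⌊ p ∣? ∣ z ∣ ⌋) resultant≡1) p∤1ᵇ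
      where
      a = nth (one ∷ u ++ Vec.replicate d zero)
      A = sylvesterMatrix d a
      N = selectRows (isGRow d) A (sylvester-∂yd d)
      N-unselected = selectRows-unselected {S = isGRow d} {A} {sylvester-∂yd d}
      N-selected   = selectRows-selected {S = isGRow d} {A} {sylvester-∂yd d}
      pencil≗N : ∀ r c → pencil A (sylvester-∂yd d) (+ 1) r c ≡ N r c
      pencil≗N r c with row-cases {d} r
      ... | inj₁ (r<d , fRow) = begin
        A r c + + 1 * sylvester-∂yd d r c   ≡⟨ cong (λ x → A r c + + 1 * x) (sylvester-∂yd-fRow {d} r c fRow) ⟩
        A r c + + 1 * + 0                   ≡⟨ x+t*0≡x (A r c) (+ 1) ⟩
        A r c                               ≡⟨ N-unselected fRow c ⟨
        N r c                               ∎
        where open ≡-Reasoning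
      ... | inj₂ (d≤r , gRow) = begin
        A r c + + 1 * sylvester-∂yd d r c   ≡⟨ cong (λ x → x + + 1 * sylvester-∂yd d r c) A-gRow≡0 ⟩
        + 0 + + 1 * sylvester-∂yd d r c     ≡⟨ trans (+-identityˡ _) (*-identityˡ _) ⟩
        sylvester-∂yd d r c                 ≡⟨ N-selected gRow c ⟨
        N r c                               ∎
        where
        open ≡-Reasoning
        A-gRow≡0 : A r c ≡ + 0
        A-gRow≡0 = trans (sylvesterMatrix-gRow {d} a {r} {c} d≤r) (band-≡0 {d} y≡0 (toℕ r ∸ d) (toℕ c))
          where
          y≡0 : ∀ k → k ℕ.≤ d → a (suc d ℕ.+ k) ≡ + 0
          y≡0 k _ = trans (nth-++ʳ (one ∷ u) (Vec.replicate d zero) k) (nth-replicate-zero d k)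
      resultant≡1 : resultant d (one ∷ u ++ (Vec.replicate d zero ∷ʳ one)) ≡ + 1
      resultant≡1 = trans (resultant-pencil one u (Vec.replicate d zero) one)
                      (trans (det-cong pencil≗N) (det-sylvester-leading≡1 {d} a refl))
      p∤1ᵇ : not ⌊ p ∣? 1 ⌋ ≡ true
      p∤1ᵇ with p ∣? 1
      ... | yes p∣1 = ⊥-elim (p∤1 p∣1)
      ... | no  _   = refl

open Sylvester

open import Data.Nat using (ℕ; zero; suc; _+_; _*_; _^_; _∸_; _≤_; _<_; z≤n; s≤s)
open import Data.Nat.Properties
open import Data.Nat.Primality using (Prime)
open import Data.Nat.Tactic.RingSolver using (solve-∀)
open import Data.Bool using (Bool; T)
open import Data.Fin using (Fin; zero; suc)
open import Data.Integer as ℤ using (+_; +≤+)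
import Data.Integer.Properties as ℤ
open import Data.Integer.Solver using (module +-*-Solver)
open import Data.List using (length)
open import Data.Product using (_×_; _,_)
open import Data.Rational using (1ℚ; _-_)
import Data.Rational as ℚ
import Data.Rational.Properties as ℚ
open import Data.Rational.Unnormalised as ℚᵘ using (mkℚᵘ; *≤*)
import Data.Rational.Unnormalised.Properties as ℚᵘ
open import Data.Unit using (tt)
open import Data.Vec using (Vec; _∷_; _∷ʳ_; replicate)
open import Relation.Binary.PropositionalEquality using (_≡_; refl; sym; trans; cong; cong₂; subst; subst₂)

toℚᵘ-ratio : ∀ a b → ℚ.toℚᵘ (ratio a (suc b)) ℚᵘ.≃ mkℚᵘ (+ a) b
toℚᵘ-ratio a b = ℚ.toℚᵘ-fromℚᵘ (mkℚᵘ (+ a) b)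

ratio-≤ : ∀ {a b c e} → 0 < b → 0 < e → a * e ≤ c * b → ratio a b ℚ.≤ ratio c e
ratio-≤ {a} {suc b} {c} {suc e} _ _ ae≤cb =
  ℚ.toℚᵘ-cancel-≤ (ℚᵘ.≤-respˡ-≃ (ℚᵘ.≃-sym (toℚᵘ-ratio a b)) (ℚᵘ.≤-respʳ-≃ (ℚᵘ.≃-sym (toℚᵘ-ratio c e))
    (*≤* (subst₂ ℤ._≤_ (ℤ.pos-* a (suc e)) (ℤ.pos-* c (suc b)) (+≤+ ae≤cb)))))

one-minus-ratio-≤ : ∀ {f b c e} → 0 < b → 0 < e → b * e ≤ c * b + f * e → 1ℚ - ratio f b ℚ.≤ ratio c e
one-minus-ratio-≤ {f} {suc b} {c} {suc e} _ _ be≤cb+fe =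
  ℚ.toℚᵘ-cancel-≤ (ℚᵘ.≤-respˡ-≃ (ℚᵘ.≃-sym lhs≃) (ℚᵘ.≤-respʳ-≃ (ℚᵘ.≃-sym (toℚᵘ-ratio c e)) unnormalised))
  where
  open +-*-Solver
  lhs≃ : ℚ.toℚᵘ (1ℚ - ratio f (suc b)) ℚᵘ.≃ mkℚᵘ (+ 1) 0 ℚᵘ.- mkℚᵘ (+ f) b
  lhs≃ = ℚᵘ.≃-trans (ℚ.toℚᵘ-homo-+ 1ℚ (ℚ.- ratio f (suc b)))
           (ℚᵘ.+-congʳ (mkℚᵘ (+ 1) 0) (ℚᵘ.≃-trans (ℚ.toℚᵘ-homo‿- (ratio f (suc b))) (ℚᵘ.-‿cong (toℚᵘ-ratio f b))))
  unnormalised : mkℚᵘ (+ 1) 0 ℚᵘ.- mkℚᵘ (+ f) b ℚᵘ.≤ mkℚᵘ (+ c) e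
  unnormalised rewrite +-identityʳ b = *≤* (begin
    (+ suc b ℤ.+ ℤ.- (+ f) ℤ.* + 1) ℤ.* + suc e
      ≡⟨ solve 3 (λ B F E → (B :+ :- F :* con (+ 1)) :* E := B :* E :- F :* E) refl (+ suc b) (+ f) (+ suc e) ⟩
    + suc b ℤ.* + suc e ℤ.- + f ℤ.* + suc e
      ≡⟨ cong₂ ℤ._-_ (ℤ.pos-* (suc b) (suc e)) (ℤ.pos-* f (suc e)) ⟨
    + (suc b * suc e) ℤ.- + (f * suc e)
      ≤⟨ ℤ.+-monoˡ-≤ (ℤ.- + (f * suc e)) (+≤+ be≤cb+fe) ⟩
    + (c * suc b + f * suc e) ℤ.- + (f * suc e)
      ≡⟨ cong (ℤ._- + (f * suc e)) (ℤ.pos-+ (c * suc b) (f * suc e)) ⟩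
    + (c * suc b) ℤ.+ + (f * suc e) ℤ.- + (f * suc e)
      ≡⟨ solve 2 (λ X Y → X :+ Y :- Y := X) refl (+ (c * suc b)) (+ (f * suc e)) ⟩
    + (c * suc b)
      ≡⟨ ℤ.pos-* c (suc b) ⟩
    + c ℤ.* + suc b ∎)
    where open ℤ.≤-Reasoning

-- In terms of D = suc d and p = suc (2 * D + s) this reads p (p ∸ 2D) ≤ (p ∸ D) (p ∸ 1).
p[p∸2d]≤[p∸d][p∸1] : ∀ d s → suc (2 * suc d + s) * suc s ≤ suc (suc d + s) * (2 * suc d + s)
p[p∸2d]≤[p∸d][p∸1] d s =
  subst (suc (2 * suc d + s) * suc s ≤_) (sym (expand d s)) (m≤m+n _ (2 * d * d + 4 * d + 1 + d * s))
  where
  expand : ∀ d s → suc (suc d + s) * (2 * suc d + s) ≡ suc (2 * suc d + s) * suc s + (2 * d * d + 4 * d + 1 + d * s)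
  expand = solve-∀

cross-multiplied-1-2d/p : ∀ {d p N G} → 1 ≤ d → 2 * d < p → N * (p ∸ 1) ≤ p ^ (suc d + suc d) →
                          p ^ d * (p ^ d * (p ∸ d)) ≤ G → p * N ≤ G * p + 2 * d * N
cross-multiplied-1-2d/p {suc d} {N = N} {G} _ 2d<p N-bound G-bound with m≤n⇒∃[o]m+o≡n 2d<p
... | s , refl = begin
  p * N                      ≡⟨ p*N≡ (suc d) s N ⟩
  2 * suc d * N + suc s * N  ≤⟨ +-monoʳ-≤ (2 * suc d * N) (≤-trans (≤-reflexive (*-comm (suc s) N)) N[p∸2d]≤Gp) ⟩
  2 * suc d * N + G * p      ≡⟨ +-comm (2 * suc d * N) (G * p) ⟩
  G * p + 2 * suc d * N      ∎
  where
  open ≤-Reasoning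
  p p∸1 p∸d X : ℕ
  p   = suc (2 * suc d + s)
  p∸1 = 2 * suc d + s
  p∸d = suc (suc d + s)
  X   = p ^ suc d
  p*N≡ : ∀ D s N → suc (2 * D + s) * N ≡ 2 * D * N + suc s * N
  p*N≡ = solve-∀
  p∸d≡ : p ∸ suc d ≡ p∸d
  p∸d≡ = trans (cong (_∸ suc d) (split d s)) (m+n∸m≡n (suc d) p∸d)
    where
    split : ∀ d s → suc (2 * suc d + s) ≡ suc d + suc (suc d + s)
    split = solve-∀
  N[p∸1]≤pX[pX] : N * p∸1 ≤ p * (X * (p * X))
  N[p∸1]≤pX[pX] = subst (λ y → N * p∸1 ≤ p * y) (^-distribˡ-+-* p (suc d) (suc (suc d))) N-bound
  XX[p∸d]≤G : X * (X * p∸d) ≤ G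
  XX[p∸d]≤G = subst (λ y → X * (X * y) ≤ G) p∸d≡ G-bound
  N[p∸2d]≤Gp : N * suc s ≤ G * p
  N[p∸2d]≤Gp = *-cancelʳ-≤ (N * suc s) (G * p) p∸1 (begin
    N * suc s * p∸1            ≡⟨ reorder₁ N (suc s) p∸1 ⟩
    N * p∸1 * suc s            ≤⟨ *-monoˡ-≤ (suc s) N[p∸1]≤pX[pX] ⟩
    p * (X * (p * X)) * suc s  ≡⟨ reorder₂ p X (suc s) ⟩
    X * X * p * (p * suc s)    ≤⟨ *-monoʳ-≤ (X * X * p) (p[p∸2d]≤[p∸d][p∸1] d s) ⟩
    X * X * p * (p∸d * p∸1)    ≡⟨ reorder₃ X p p∸d p∸1 ⟩
    X * (X * p∸d) * p * p∸1    ≤⟨ *-monoˡ-≤ p∸1 (*-monoˡ-≤ p XX[p∸d]≤G) ⟩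
    G * p * p∸1                ∎)
    where
    reorder₁ : ∀ a b c → a * b * c ≡ a * c * b
    reorder₁ = solve-∀
    reorder₂ : ∀ p X e → p * (X * (p * X)) * e ≡ X * X * p * (p * e)
    reorder₂ = solve-∀
    reorder₃ : ∀ X p a b → X * X * p * (a * b) ≡ X * (X * a) * p * b
    reorder₃ = solve-∀

cross-multiplied-p^-2d : ∀ {d q N G} → 2 ≤ d → N * suc q ≤ suc (suc q) ^ (suc d + suc d) → suc (suc q) ^ d ≤ G →
                         1 * N ≤ G * suc (suc q) ^ (2 * d)
cross-multiplied-p^-2d {d} {q} {N} {G} 2≤d N-bound G-bound = begin
  1 * N                   ≡⟨ *-identityˡ N ⟩
  N                       ≤⟨ m≤m*n N (suc q) ⟩
  N * suc q               ≤⟨ N-bound ⟩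
  p ^ (suc d + suc d)     ≤⟨ ^-monoʳ-≤ p exponent-≤ ⟩
  p ^ (d + 2 * d)         ≡⟨ ^-distribˡ-+-* p d (2 * d) ⟩
  p ^ d * p ^ (2 * d)     ≤⟨ *-monoˡ-≤ (p ^ (2 * d)) G-bound ⟩
  G * p ^ (2 * d)         ∎
  where
  open ≤-Reasoning
  p = suc (suc q)
  exponent-≤ : suc d + suc d ≤ d + 2 * d
  exponent-≤ = ≤-trans (≤-reflexive (2+2d d)) (+-monoˡ-≤ (2 * d) 2≤d)
    where
    2+2d : ∀ d → suc d + suc d ≡ 2 + 2 * d
    2+2d = solve-∀

module _ {q : ℕ} (d : ℕ) where

  private
    p : ℕ
    p = suc (suc q)

    one : Fin p
    one = suc zero

    goodInChart : Vec (Fin p) (d + suc d) → Bool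
    goodInChart w = resNonzero p d (one ∷ w)

  good-≥-p^d : p ^ d ≤ count (resNonzero p d) (projPoints p (suc d + suc d))
  good-≥-p^d = ≤-trans (subst (_≤ count goodInChart (allVecs p (d + suc d))) (*-identityʳ (p ^ d)) one-per-prefix)
                       (count-chart-≤ q (d + suc d) (resNonzero p d))
    where
    one-per-prefix : p ^ d * 1 ≤ count goodInChart (allVecs p (d + suc d))
    one-per-prefix = count-allVecs-++-≥ d goodInChart
      (λ u → count-member _ (∈-allVecs (replicate d zero ∷ʳ one)) (subst T (sym (resNonzero-g≡Xᵈ u)) tt))

  good-≥-p^2d[p∸d] : Prime p → p ^ d * (p ^ d * (p ∸ d)) ≤ count (resNonzero p d) (projPoints p (suc d + suc d))
  good-≥-p^2d[p∸d] p-prime = ≤-trans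
    (count-allVecs-++-≥ d goodInChart (λ u → count-allVecs-∷ʳ-≥ _ (λ w → count-good-yd-≥ p-prime u w)))
    (count-chart-≤ q (d + suc d) (resNonzero p d))

corollary4p10 : (d p : ℕ) → 2 ≤ d → Prime p →
    (ratio 1 (p ^ (2 * d)) ℚ.≤ densityGood p d)
    × (2 * d < p → 1ℚ - ratio (2 * d) p ℚ.≤ densityGood p d)
corollary4p10 d (suc (suc q)) 2≤d p-prime =
  ratio-≤ (m^n>0 (suc (suc q)) (2 * d)) #ℙ>0 (cross-multiplied-p^-2d 2≤d #ℙ-bound (good-≥-p^d d)) ,
  λ 2d<p → one-minus-ratio-≤ {f = 2 * d} {c = #good} (s≤s z≤n) #ℙ>0
             (cross-multiplied-1-2d/p {N = #ℙ} (≤-trans (s≤s z≤n) 2≤d) 2d<p #ℙ-bound (good-≥-p^2d[p∸d] d p-prime))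
  where
  #ℙ #good : ℕ
  #ℙ    = length (projPoints (suc (suc q)) (suc d + suc d))
  #good = count (resNonzero (suc (suc q)) d) (projPoints (suc (suc q)) (suc d + suc d))
  #ℙ>0 : 0 < #ℙ
  #ℙ>0 = projPoints-nonempty q (d + suc d)
  #ℙ-bound : #ℙ * suc q ≤ suc (suc q) ^ (suc d + suc d)
  #ℙ-bound = length-projPoints-bound q (suc d + suc d)
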